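{- Let $d\ge 2$ and let $D$ be a domain in $T_d$ with $|D|\ge 2$ and $|D|\equiv 2\pmod{d-1}$. Then $D$ is optimal if and only if $D$ is full.
   Context: $T_d$ is the $d$-regular tree. A domain is a finite nonempty connected set of vertices of $T_d$. For $x\in D$, $\deg_D(x)$ is the number of neighbors of $x$ in $D$; $\partial D=\{x\in D\mid\deg_D(x)<d\}$. $I_d(k)=\min\{|\partial D|\mid D\text{ a domain},|D|=k\}$; $D$ is optimal if $|\partial D|=I_d(|D|)$. A domain $D$ with $|D|\ge2$ is full if every vertex of $\partial D$ satisfies $\deg_D(x)=1$. -}

module Defs where

open import Data.Nat using (ℕ; zero; suc; _≤_; _<ᵇ_)
open import Data.Fin using (Fin)
import Data.Fin.Properties as FinP
open import Data.List using (List; []; _∷_; length; filterᵇ)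
open import Data.List.Properties using (≡-dec)
open import Data.List.Membership.Propositional using (_∈_)
open import Data.List.Relation.Unary.All using (All)
open import Data.List.Relation.Unary.Unique.Propositional using (Unique)
open import Data.Bool using (Bool; true; false; _∨_; T)
open import Data.Product using (_×_)
open import Data.Unit using (⊤)
open import Relation.Binary.PropositionalEquality using (_≡_; _≢_)
open import Relation.Nullary.Decidable using (isYes)

-- The d-regular tree T_d is modelled as the Cayley graph of the free product
-- of d copies of Z/2: vertices are reduced words over the alphabet Fin d
-- (no two consecutive equal letters); a word w is adjacent to a ∷ w.
-- The root [] has d neighbours, every other vertex has (d-1) children + 1 parent.

Vertex : ℕ → Set
Vertex d = List (Fin d)

Reduced : {d : ℕ} → Vertex d → Set
Reduced [] = ⊤
Reduced (a ∷ []) = ⊤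
Reduced (a ∷ b ∷ w) = (a ≢ b) × Reduced (b ∷ w)

isChild : {d : ℕ} → Vertex d → Vertex d → Bool
isChild v [] = false
isChild v (a ∷ w) = isYes (≡-dec FinP._≟_ v w)

adj : {d : ℕ} → Vertex d → Vertex d → Bool
adj v w = isChild v w ∨ isChild w v

data Walk {d : ℕ} (D : List (Vertex d)) : Vertex d → Vertex d → Set where
  here : ∀ {x} → x ∈ D → Walk D x x
  step : ∀ {x y z} → x ∈ D → T (adj x y) → Walk D y z → Walk D x z

-- A domain: a finite nonempty connected set of vertices of T_d
-- (finite set = duplicate-free list of reduced words).
record Domain (d : ℕ) : Set where
  field
    verts     : List (Vertex d)
    unique    : Unique verts
    reduced   : All Reduced verts
    nonempty  : 1 ≤ length verts
    connected : ∀ {x y} → x ∈ verts → y ∈ verts → Walk verts x y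
open Domain public

size : {d : ℕ} → Domain d → ℕ
size D = length (verts D)

deg : {d : ℕ} → Domain d → Vertex d → ℕ
deg D x = length (filterᵇ (adj x) (verts D))

boundary : {d : ℕ} → Domain d → List (Vertex d)
boundary {d} D = filterᵇ (λ x → deg D x <ᵇ d) (verts D)

Optimal : {d : ℕ} → Domain d → Set
Optimal {d} D = ∀ (D' : Domain d) → size D' ≡ size D →
  length (boundary D) ≤ length (boundary D')

Full : {d : ℕ} → Domain d → Set
Full D = (2 ≤ size D) × (∀ {x} → x ∈ boundary D → deg D x ≡ 1)

-- Write d = e + 2, b = |∂D|, j = |D \ ∂D| and s for the sum of the degrees over ∂D. A domain
-- is a subtree of T_d, so its degrees sum to 2(|D| − 1), and interior vertices have degree
-- exactly d; hence 2b = s + e·j + 2. When |D| ≥ 2 every degree is at least 1, so s ≥ b and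
-- b ≥ e·j + 2, with equality exactly when D is full. As b + j = |D|, a full domain has the
-- least b among domains of its size. Conversely, if |D| = q(e + 1) + 2, a caterpillar of this
-- size with q interior vertices shows that an optimal D has j ≥ q, which forces b ≤ e·j + 2,
-- i.e. D is full.

module Submission where

open import Defs
open import Data.Nat using (ℕ; _≤_; _∸_; suc; _+_; _*_; _<_; _<ᵇ_; _≤′_; ≤′-refl; ≤′-step; z≤n; s≤s)
open import Data.Nat.Divisibility using (_∣_; divides)
open import Data.Product using (_×_; ∃-syntax; _,_; proj₁; proj₂)
open import Function.Bundles using (_⇔_; mk⇔)

open import Data.Bool using (Bool; true; false; T; _∨_; if_then_else_)
open import Data.Bool.Properties using (T-∨; T-≡)
open import Data.Empty using (⊥; ⊥-elim)
open import Data.Fin using (Fin; zero; suc)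
import Data.Fin.Properties as Fin
open import Data.List using (List; []; _∷_; _++_; length; filter; filterᵇ; map; allFin; tabulate; applyUpTo)
open import Data.List.Extrema.Nat using (argmin; argmin-sel; f[argmin]≤f[⊤]; f[argmin]≤f[xs])
open import Data.List.Membership.Propositional using (_∈_)
open import Data.List.Membership.Propositional.Properties
  using (∈-filter⁺; ∈-filter⁻; ∈-length; ∈-allFin; ∈-++⁺ˡ; ∈-++⁺ʳ; ∈-++⁻; ∈-tabulate⁻; ∈-applyUpTo⁻)
open import Data.List.Properties
  using (≡-dec; ∷-injective; filter-notAll; length-++; length-++-≤ʳ; length-map; length-tabulate; length-applyUpTo)
open import Data.List.Relation.Binary.Subset.Propositional using (_⊆_)
open import Data.List.Relation.Unary.All as All using (All; []; _∷_)
import Data.List.Relation.Unary.All.Properties as All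
open import Data.List.Relation.Unary.AllPairs using ([]; _∷_)
open import Data.List.Relation.Unary.Any as Any using (here; there)
open import Data.List.Relation.Unary.Unique.Propositional using (Unique)
import Data.List.Relation.Unary.Unique.Propositional.Properties as Unique
open import Data.Nat.Properties
open import Algebra.Properties.CommutativeSemigroup +-commutativeSemigroup using (interchange; x∙yz≈y∙xz)
open import Data.Nat.Tactic.RingSolver using (solve-∀)
open import Data.Sum using (_⊎_; inj₁; inj₂)
open import Data.Unit using (tt)
open import Function using (_∘_; id; Equivalence)
open import Relation.Binary.Definitions using (DecidableEquality)
open import Relation.Binary.PropositionalEquality
open import Relation.Nullary using (¬_; yes; no; ¬?)
open import Relation.Nullary.Decidable using (T?; toWitness; fromWitness)
open import Relation.Unary using (Pred; Decidable)
open import Relation.Unary.Properties using (∁?)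

private variable
  A B : Set
  t : A
  xs ys : List A
  f g : A → ℕ

∑ : List A → (A → ℕ) → ℕ
∑ [] f = 0
∑ (x ∷ xs) f = f x + ∑ xs f

syntax ∑ xs (λ x → e) = ∑[ x ∈ xs ] e

∑-cong : (∀ {x} → x ∈ xs → f x ≡ g x) → ∑ xs f ≡ ∑ xs g
∑-cong {xs = []}     _  = refl
∑-cong {xs = x ∷ xs} eq = cong₂ _+_ (eq (here refl)) (∑-cong (eq ∘ there))

∑-+ : ∀ xs → ∑[ x ∈ xs ] (f x + g x) ≡ ∑ xs f + ∑ xs g
∑-+                 []       = refl
∑-+ {f = f} {g = g} (x ∷ xs) =
  trans (cong (f x + g x +_) (∑-+ xs)) (interchange (f x) (g x) (∑ xs f) (∑ xs g))

∑-const : ∀ c (xs : List A) → ∑[ x ∈ xs ] c ≡ length xs * c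
∑-const c []       = refl
∑-const c (x ∷ xs) = cong (c +_) (∑-const c xs)

length≤∑ : (∀ {x} → x ∈ xs → 1 ≤ f x) → length xs ≤ ∑ xs f
length≤∑ {xs = []}     _   = z≤n
length≤∑ {xs = x ∷ xs} pos = +-mono-≤ (pos (here refl)) (length≤∑ (pos ∘ there))

∑≤length⇒≡1 : (∀ {x} → x ∈ xs → 1 ≤ f x) → ∑ xs f ≤ length xs → ∀ {x} → x ∈ xs → f x ≡ 1
∑≤length⇒≡1 {xs = y ∷ ys} {f = f} pos le (here refl) =
  ≤-antisym (+-cancelʳ-≤ (length ys) (f y) 1 (≤-trans (+-monoʳ-≤ (f y) (length≤∑ (pos ∘ there))) le))
            (pos (here refl))
∑≤length⇒≡1 {xs = y ∷ ys} {f = f} pos le (there x∈ys) =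
  ∑≤length⇒≡1 (pos ∘ there) (+-cancelˡ-≤ 1 _ _ (≤-trans (+-monoˡ-≤ (∑ ys f) (pos (here refl))) le)) x∈ys

∑-ones-but-one : Unique xs → t ∈ xs → f t ≡ 0 → (∀ {y} → y ∈ xs → y ≢ t → f y ≡ 1) →
                 suc (∑ xs f) ≡ length xs
∑-ones-but-one {xs = x ∷ xs} {f = f} (x∉xs ∷ _) (here refl) ft≡0 ones = cong suc (begin
  f x + ∑ xs f         ≡⟨ cong (_+ ∑ xs f) ft≡0 ⟩
  ∑[ y ∈ xs ] f y      ≡⟨ ∑-cong (λ y∈xs → ones (there y∈xs) (≢-sym (All.lookup x∉xs y∈xs))) ⟩
  ∑[ y ∈ xs ] 1        ≡⟨ ∑-const 1 xs ⟩
  length xs * 1        ≡⟨ *-identityʳ (length xs) ⟩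
  length xs            ∎)
  where open ≡-Reasoning
∑-ones-but-one {xs = x ∷ xs} {f = f} (x∉xs ∷ u) (there t∈xs) ft≡0 ones =
  cong suc (trans (cong (_+ ∑ xs f) (ones (here refl) (All.lookup x∉xs t∈xs)))
                  (∑-ones-but-one u t∈xs ft≡0 (ones ∘ there)))

module _ {p} {P : Pred A p} (P? : Decidable P) where

  ∑-split-filter : ∀ (f : A → ℕ) xs → ∑ xs f ≡ ∑ (filter P? xs) f + ∑ (filter (∁? P?) xs) f
  ∑-split-filter f []       = refl
  ∑-split-filter f (x ∷ xs) with P? x
  ... | yes _ = trans (cong (f x +_) (∑-split-filter f xs)) (sym (+-assoc (f x) (∑ (filter P? xs) f) _))
  ... | no  _ = trans (cong (f x +_) (∑-split-filter f xs)) (x∙yz≈y∙xz (f x) (∑ (filter P? xs) f) _)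

  length-split-filter : ∀ (xs : List A) → length xs ≡ length (filter P? xs) + length (filter (∁? P?) xs)
  length-split-filter []       = refl
  length-split-filter (x ∷ xs) with P? x
  ... | yes _ = cong suc (length-split-filter xs)
  ... | no  _ = trans (cong suc (length-split-filter xs)) (sym (+-suc _ _))

length-filterᵇ-∷ : ∀ (p : A → Bool) x xs →
  length (filterᵇ p (x ∷ xs)) ≡ (if p x then 1 else 0) + length (filterᵇ p xs)
length-filterᵇ-∷ p x xs with p x
... | true  = refl
... | false = refl

length-filterᵇ≡∑ : ∀ (p : A → Bool) xs → length (filterᵇ p xs) ≡ ∑[ x ∈ xs ] (if p x then 1 else 0)
length-filterᵇ≡∑ p []       = refl
length-filterᵇ≡∑ p (x ∷ xs) = trans (length-filterᵇ-∷ p x xs) (cong (_ +_) (length-filterᵇ≡∑ p xs))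

length-filterᵇ-∨ : ∀ (p q : A → Bool) → (∀ x → T (p x) → ¬ T (q x)) → ∀ xs →
  length (filterᵇ (λ x → p x ∨ q x) xs) ≡ length (filterᵇ p xs) + length (filterᵇ q xs)
length-filterᵇ-∨ p q disjoint []       = refl
length-filterᵇ-∨ p q disjoint (x ∷ xs) with p x in px | q x in qx
... | true  | true  = ⊥-elim (disjoint x (Equivalence.from T-≡ px) (Equivalence.from T-≡ qx))
... | true  | false = cong suc (length-filterᵇ-∨ p q disjoint xs)
... | false | true  = trans (cong suc (length-filterᵇ-∨ p q disjoint xs)) (sym (+-suc _ _))
... | false | false = length-filterᵇ-∨ p q disjoint xs

∑-length-filterᵇ-swap : ∀ (R : A → B → Bool) xs ys →
  ∑[ x ∈ xs ] length (filterᵇ (R x) ys) ≡ ∑[ y ∈ ys ] length (filterᵇ (λ x → R x y) xs)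
∑-length-filterᵇ-swap R []       ys = sym (trans (∑-const 0 ys) (*-zeroʳ (length ys)))
∑-length-filterᵇ-swap R (x ∷ xs) ys = begin
  length (filterᵇ (R x) ys) + ∑[ x ∈ xs ] length (filterᵇ (R x) ys)
    ≡⟨ cong₂ _+_ (length-filterᵇ≡∑ (R x) ys) (∑-length-filterᵇ-swap R xs ys) ⟩
  ∑[ y ∈ ys ] (if R x y then 1 else 0) + ∑[ y ∈ ys ] length (filterᵇ (λ x → R x y) xs)
    ≡⟨ ∑-+ {f = λ y → if R x y then 1 else 0} ys ⟨
  ∑[ y ∈ ys ] ((if R x y then 1 else 0) + length (filterᵇ (λ x → R x y) xs))
    ≡⟨ ∑-cong {xs = ys} (λ {y} _ → length-filterᵇ-∷ (λ x → R x y) x xs) ⟨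
  ∑[ y ∈ ys ] length (filterᵇ (λ x → R x y) (x ∷ xs)) ∎
  where open ≡-Reasoning

module _ {A : Set} (_≟_ : DecidableEquality A) where

  length-mono-⊆ : {xs ys : List A} → Unique xs → xs ⊆ ys → length xs ≤ length ys
  length-mono-⊆ {xs = []}              _            _     = z≤n
  length-mono-⊆ {xs = x ∷ xs} {ys = ys} (x∉xs ∷ xs!) xs⊆ys = begin-strict
    length xs                      ≤⟨ length-mono-⊆ xs! (λ y∈xs → ∈-filter⁺ x≢? (xs⊆ys (there y∈xs)) (All.lookup x∉xs y∈xs)) ⟩
    length (filter x≢? ys)         <⟨ filter-notAll x≢? ys (Any.map (λ x≡y x≢y → x≢y x≡y) (xs⊆ys (here refl))) ⟩
    length ys                      ∎
    where
    open ≤-Reasoning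
    x≢? = ¬? ∘ (x ≟_)

  ∃-≢ : {xs : List A} → Unique xs → 2 ≤ length xs → (x : A) → ∃[ y ] y ∈ xs × x ≢ y
  ∃-≢ {xs = y ∷ z ∷ _} ((y≢z ∷ _) ∷ _) _ x with x ≟ y
  ... | yes refl = z , there (here refl) , y≢z
  ... | no  x≢y  = y , here refl , x≢y
  ∃-≢ {xs = _ ∷ []} _ (s≤s ()) _

Unique-map⁺ : (f : A → B) → (∀ {x y} → x ∈ xs → y ∈ xs → f x ≡ f y → x ≡ y) → Unique xs → Unique (map f xs)
Unique-map⁺ {xs = []}     f inj []           = []
Unique-map⁺ {xs = x ∷ xs} f inj (x∉xs ∷ xs!) =
  All.map⁺ (All.tabulate (λ {y} y∈xs fx≡fy → All.lookup x∉xs y∈xs (inj (here refl) (there y∈xs) fx≡fy)))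
  ∷ Unique-map⁺ f (λ x∈ y∈ → inj (there x∈) (there y∈)) xs!

∃-minimal : (f : A → ℕ) → 1 ≤ length xs → ∃[ t ] t ∈ xs × (∀ {y} → y ∈ xs → f t ≤ f y)
∃-minimal {xs = x ∷ xs} f _ = argmin f x xs , argmin∈ (argmin-sel f x xs) , minimal
  where
  argmin∈ : argmin f x xs ≡ x ⊎ argmin f x xs ∈ xs → argmin f x xs ∈ x ∷ xs
  argmin∈ (inj₁ eq) = here eq
  argmin∈ (inj₂ m)  = there m
  minimal : ∀ {y} → y ∈ x ∷ xs → f (argmin f x xs) ≤ f y
  minimal (here refl) = f[argmin]≤f[⊤] {f = f} x xs
  minimal (there y∈xs) = All.lookup (f[argmin]≤f[xs] {f = f} x xs) y∈xs

x≢a∷b∷x : ∀ {x : List A} {a b} → x ≢ a ∷ b ∷ x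
x≢a∷b∷x ()

module _ {d : ℕ} where

  private variable
    a : Fin d
    u v w z : Vertex d
    V : List (Vertex d)

  _≟ᵥ_ : DecidableEquality (Vertex d)
  _≟ᵥ_ = ≡-dec Fin._≟_

  data Adjacent : Vertex d → Vertex d → Set where
    child  : ∀ a v → Adjacent v (a ∷ v)
    parent : ∀ a v → Adjacent (a ∷ v) v

  isChild-∷ : ∀ a (v : Vertex d) → T (isChild v (a ∷ v))
  isChild-∷ a v = fromWitness {a? = v ≟ᵥ v} refl

  isChild⇒≡∷ : T (isChild v w) → ∃[ a ] w ≡ a ∷ v
  isChild⇒≡∷ {v} {a ∷ w} c = a , cong (a ∷_) (sym (toWitness {a? = v ≟ᵥ w} c))

  isChild⇒Adjacent : T (isChild v w) → Adjacent v w
  isChild⇒Adjacent {v} {w} c with isChild⇒≡∷ {v} {w} c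
  ... | a , refl = child a v

  Adjacent-sym : Adjacent v w → Adjacent w v
  Adjacent-sym (child a v)  = parent a v
  Adjacent-sym (parent a v) = child a v

  adj⇒Adjacent : T (adj v w) → Adjacent v w
  adj⇒Adjacent t with Equivalence.to T-∨ t
  ... | inj₁ c = isChild⇒Adjacent c
  ... | inj₂ c = Adjacent-sym (isChild⇒Adjacent c)

  Adjacent⇒adj : Adjacent v w → T (adj v w)
  Adjacent⇒adj (child a v)  = Equivalence.from T-∨ (inj₁ (isChild-∷ a v))
  Adjacent⇒adj (parent a v) = Equivalence.from T-∨ (inj₂ (isChild-∷ a v))

  isChild-asym : T (isChild v w) → ¬ T (isChild w v)
  isChild-asym {v} {w} c c′ with isChild⇒≡∷ {v} {w} c | isChild⇒≡∷ {w} {v} c′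
  ... | a , refl | b , ()

  walk-source : Walk V v w → v ∈ V
  walk-source (here v∈V)     = v∈V
  walk-source (step v∈V _ _) = v∈V

  walk-++ : Walk V u v → Walk V v w → Walk V u w
  walk-++ (here _)         q = q
  walk-++ (step u∈V uv p)  q = step u∈V uv (walk-++ p q)

  -- The words u ++ w are the descendants of w; a walk leaving them passes through the parent of w.
  walk-exit : ∀ u → v ≡ u ++ w → Walk V v z →
              (∃[ u′ ] z ≡ u′ ++ w) ⊎ (∃[ a ] ∃[ w₀ ] w ≡ a ∷ w₀ × w₀ ∈ V)
  walk-exit u v≡uw (here _) = inj₁ (u , v≡uw)
  walk-exit {v = v} u v≡uw (step {y = y} _ vy p) with adj⇒Adjacent {v} {y} vy
  ... | child a _ = walk-exit (a ∷ u) (cong (a ∷_) v≡uw) p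
  walk-exit []      refl (step _ _ p) | parent a y = inj₂ (a , y , refl , walk-source p)
  walk-exit (_ ∷ u) eq   (step _ _ p) | parent a y = walk-exit u (proj₂ (∷-injective eq)) p

  ParentClosed : List (Vertex d) → Set
  ParentClosed V = ∀ {a w} → a ∷ w ∈ V → w ∈ V

  module _ (closed : ParentClosed V) where

    walk-to-root : v ∈ V → Walk V v []
    walk-to-root {[]}    v∈V = here v∈V
    walk-to-root {a ∷ v} v∈V = step v∈V (Adjacent⇒adj (parent a v)) (walk-to-root (closed v∈V))

    walk-from-root : v ∈ V → Walk V [] v
    walk-from-root {[]}    v∈V = here v∈V
    walk-from-root {a ∷ v} v∈V =
      walk-++ (walk-from-root (closed v∈V)) (step (closed v∈V) (Adjacent⇒adj (child a v)) (here v∈V))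

    parentClosed⇒connected : v ∈ V → w ∈ V → Walk V v w
    parentClosed⇒connected v∈V w∈V = walk-++ (walk-to-root v∈V) (walk-from-root w∈V)

-- Degrees in a domain

module _ {d : ℕ} (D : Domain d) where

  private
    V : List (Vertex d)
    V = verts D

  children parents : Vertex d → List (Vertex d)
  children x = filterᵇ (isChild x) V
  parents  y = filterᵇ (λ x → isChild x y) V

  deg≡children+parents : ∀ x → deg D x ≡ length (children x) + length (parents x)
  deg≡children+parents x = length-filterᵇ-∨ (isChild x) (λ y → isChild y x) (λ y → isChild-asym {v = x} {w = y}) V

  ∈-parents⁻ : ∀ {x y} → x ∈ parents y → ∃[ a ] y ≡ a ∷ x × x ∈ V
  ∈-parents⁻ {x} {y} x∈ with ∈-filter⁻ (T? ∘ λ x → isChild x y) {xs = V} x∈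
  ... | x∈V , c with isChild⇒≡∷ {v = x} {w = y} c
  ...   | a , y≡a∷x = a , y≡a∷x , x∈V

  length-parents-∷ : ∀ {a w} → w ∈ V → length (parents (a ∷ w)) ≡ 1
  length-parents-∷ {a} {w} w∈V = ≤-antisym
    (length-mono-⊆ _≟ᵥ_ (Unique.filter⁺ _ (unique D)) parents⊆[w])
    (length-mono-⊆ _≟ᵥ_ ([] ∷ []) λ { (here refl) → ∈-filter⁺ _ w∈V (isChild-∷ a w) })
    where
    parents⊆[w] : parents (a ∷ w) ⊆ w ∷ []
    parents⊆[w] x∈ with ∈-parents⁻ {y = a ∷ w} x∈
    ... | _ , refl , _ = here refl

  module _ {t : Vertex d} (t∈V : t ∈ V) (shortest : ∀ {y} → y ∈ V → length t ≤ length y) where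

    length-parents-shortest : length (parents t) ≡ 0
    length-parents-shortest = n≤0⇒n≡0 (length-mono-⊆ _≟ᵥ_ (Unique.filter⁺ _ (unique D)) parents⊆[])
      where
      parents⊆[] : parents t ⊆ []
      parents⊆[] x∈ with ∈-parents⁻ {y = t} x∈
      ... | _ , refl , x∈V = ⊥-elim (1+n≰n (shortest x∈V))

    parent∈ : ∀ {y} → y ∈ V → y ≢ t → ∃[ a ] ∃[ w ] y ≡ a ∷ w × w ∈ V
    parent∈ {y} y∈V y≢t with walk-exit [] refl (connected D y∈V t∈V)
    ... | inj₂ has-parent    = has-parent
    ... | inj₁ ([]    , t≡y) = ⊥-elim (y≢t (sym t≡y))
    ... | inj₁ (a ∷ u , refl) = ⊥-elim (1+n≰n (≤-trans (s≤s (length-++-≤ʳ y {u})) (shortest y∈V)))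

  -- Only a shortest vertex of D lacks a parent in D, so D has size D − 1 edges.
  ∑-length-parents : suc (∑[ y ∈ V ] length (parents y)) ≡ size D
  ∑-length-parents with ∃-minimal length (nonempty D)
  ... | t , t∈V , shortest = ∑-ones-but-one (unique D) t∈V (length-parents-shortest t∈V shortest) has-one-parent
    where
    has-one-parent : ∀ {y} → y ∈ V → y ≢ t → length (parents y) ≡ 1
    has-one-parent y∈V y≢t with parent∈ t∈V shortest y∈V y≢t
    ... | a , _ , refl , w∈V = length-parents-∷ {a = a} w∈V

  handshake : ∑[ x ∈ V ] deg D x + 2 ≡ size D + size D
  handshake = begin
    ∑[ x ∈ V ] deg D x + 2                                       ≡⟨ cong (_+ 2) (∑-cong {xs = V} (λ {x} _ → deg≡children+parents x)) ⟩
    ∑[ x ∈ V ] (length (children x) + length (parents x)) + 2     ≡⟨ cong (_+ 2) (∑-+ V) ⟩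
    ∑[ x ∈ V ] length (children x) + P + 2                        ≡⟨ cong (λ c → c + P + 2) (∑-length-filterᵇ-swap isChild V V) ⟩
    P + P + 2                                                     ≡⟨ P+P+2≡suc[P]+suc[P] ⟩
    suc P + suc P                                                 ≡⟨ cong₂ _+_ ∑-length-parents ∑-length-parents ⟩
    size D + size D                                               ∎
    where
    open ≡-Reasoning
    P : ℕ
    P = ∑[ y ∈ V ] length (parents y)
    P+P+2≡suc[P]+suc[P] : P + P + 2 ≡ suc P + suc P
    P+P+2≡suc[P]+suc[P] = +-suc-+ P
      where
      +-suc-+ : ∀ n → n + n + 2 ≡ suc n + suc n
      +-suc-+ = solve-∀

  deg-pos : 2 ≤ size D → ∀ {x} → x ∈ V → 1 ≤ deg D x
  deg-pos two {x} x∈V with ∃-≢ _≟ᵥ_ (unique D) two x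
  ... | y , y∈V , x≢y = first-step (connected D x∈V y∈V) x≢y
    where
    first-step : ∀ {y} → Walk V x y → x ≢ y → 1 ≤ deg D x
    first-step (here _)        x≢x = ⊥-elim (x≢x refl)
    first-step (step _ xz p) _     = ∈-length (∈-filter⁺ (T? ∘ adj x) (walk-source p) xz)

module _ {n : ℕ} where

  private variable
    v y₁ y₂ : Vertex (suc n)

  headOrZero : Vertex (suc n) → Fin (suc n)
  headOrZero []      = zero
  headOrZero (a ∷ _) = a

  -- For adjacent x and y this is the head of the longer word; since the words are reduced,
  -- distinct neighbours of x get distinct labels. The default zero is only reached when x and
  -- y are not adjacent.
  edgeLabel : Vertex (suc n) → Vertex (suc n) → Fin (suc n)
  edgeLabel x y = headOrZero (if isChild x y then y else x)

  edgeLabel-child : ∀ a x → edgeLabel x (a ∷ x) ≡ a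
  edgeLabel-child a x rewrite Equivalence.to T-≡ (isChild-∷ a x) = refl

  edgeLabel-parent : ∀ a y → edgeLabel (a ∷ y) y ≡ a
  edgeLabel-parent a y with isChild (a ∷ y) y in eq
  ... | true  = ⊥-elim (isChild-asym {v = y} (isChild-∷ a y) (Equivalence.from T-≡ eq))
  ... | false = refl

  edgeLabel-injective : Adjacent v y₁ → Adjacent v y₂ → Reduced y₁ → Reduced y₂ →
                        edgeLabel v y₁ ≡ edgeLabel v y₂ → y₁ ≡ y₂
  edgeLabel-injective (child a x) (child b x) _ _ eq =
    cong (_∷ x) (trans (sym (edgeLabel-child a x)) (trans eq (edgeLabel-child b x)))
  edgeLabel-injective (child a _) (parent b y) (a≢b , _) _ eq =
    ⊥-elim (a≢b (trans (sym (edgeLabel-child a (b ∷ y))) (trans eq (edgeLabel-parent b y))))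
  edgeLabel-injective (parent a y) (child b _) _ (b≢a , _) eq =
    ⊥-elim (b≢a (trans (sym (edgeLabel-child b (a ∷ y))) (trans (sym eq) (edgeLabel-parent a y))))
  edgeLabel-injective (parent a y) (parent a y) _ _ _ = refl

  deg-≤ : (D : Domain (suc n)) → ∀ x → deg D x ≤ suc n
  deg-≤ D x = begin
    deg D x                                ≡⟨ length-map (edgeLabel x) N ⟨
    length (map (edgeLabel x) N)           ≤⟨ length-mono-⊆ Fin._≟_ (Unique-map⁺ (edgeLabel x) injective (Unique.filter⁺ _ (unique D))) (λ {i} _ → ∈-allFin i) ⟩
    length (allFin (suc n))                ≡⟨ length-tabulate id ⟩
    suc n                                  ∎
    where
    open ≤-Reasoning
    N : List (Vertex (suc n))
    N = filterᵇ (adj x) (verts D)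
    injective : ∀ {y₁ y₂} → y₁ ∈ N → y₂ ∈ N → edgeLabel x y₁ ≡ edgeLabel x y₂ → y₁ ≡ y₂
    injective y₁∈N y₂∈N with ∈-filter⁻ (T? ∘ adj x) y₁∈N | ∈-filter⁻ (T? ∘ adj x) y₂∈N
    ... | y₁∈V , xy₁ | y₂∈V , xy₂ = edgeLabel-injective (adj⇒Adjacent xy₁) (adj⇒Adjacent xy₂)
                                      (All.lookup (reduced D) y₁∈V) (All.lookup (reduced D) y₂∈V)

-- Boundary and interior

module _ {e : ℕ} (D : Domain (2 + e)) where

  private
    V : List (Vertex (2 + e))
    V = verts D

    onBoundary? : Decidable (λ x → T (deg D x <ᵇ 2 + e))
    onBoundary? = T? ∘ λ x → deg D x <ᵇ 2 + e

  interior : List (Vertex (2 + e))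
  interior = filter (∁? onBoundary?) V

  private
    b j s : ℕ
    b = length (boundary D)
    j = length interior
    s = ∑[ x ∈ boundary D ] deg D x

  ∈-interior⁻ : ∀ {x} → x ∈ interior → 2 + e ≤ deg D x
  ∈-interior⁻ x∈ = ≮⇒≥ (λ deg<d → proj₂ (∈-filter⁻ (∁? onBoundary?) {xs = V} x∈) (<⇒<ᵇ deg<d))

  ∈-interior⁺ : ∀ {x} → x ∈ V → 2 + e ≤ deg D x → x ∈ interior
  ∈-interior⁺ x∈V d≤deg = ∈-filter⁺ (∁? onBoundary?) x∈V (λ deg<d → <⇒≱ (<ᵇ⇒< _ _ deg<d) d≤deg)

  size≡boundary+interior : size D ≡ b + j
  size≡boundary+interior = length-split-filter onBoundary? V

  ∑-deg≡boundary+interior : ∑[ x ∈ V ] deg D x ≡ s + j * (2 + e)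
  ∑-deg≡boundary+interior = begin
    ∑[ x ∈ V ] deg D x                    ≡⟨ ∑-split-filter onBoundary? (deg D) V ⟩
    s + ∑[ x ∈ interior ] deg D x         ≡⟨ cong (s +_) (∑-cong (λ {x} x∈ → ≤-antisym (deg-≤ D x) (∈-interior⁻ x∈))) ⟩
    s + ∑[ x ∈ interior ] (2 + e)         ≡⟨ cong (s +_) (∑-const (2 + e) interior) ⟩
    s + j * (2 + e)                       ∎
    where open ≡-Reasoning

  boundary-identity : s + e * j + 2 ≡ b + b
  boundary-identity = +-cancelʳ-≡ (j + j) _ _ (begin
    s + e * j + 2 + (j + j)     ≡⟨ rearrange s j e ⟩
    s + j * (2 + e) + 2         ≡⟨ cong (_+ 2) ∑-deg≡boundary+interior ⟨
    ∑[ x ∈ V ] deg D x + 2      ≡⟨ handshake D ⟩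
    size D + size D             ≡⟨ cong₂ _+_ size≡boundary+interior size≡boundary+interior ⟩
    (b + j) + (b + j)           ≡⟨ interchange b j b j ⟩
    b + b + (j + j)             ∎)
    where
    open ≡-Reasoning
    rearrange : ∀ s j e → s + e * j + 2 + (j + j) ≡ s + j * (2 + e) + 2
    rearrange = solve-∀

  deg-pos-boundary : 2 ≤ size D → ∀ {x} → x ∈ boundary D → 1 ≤ deg D x
  deg-pos-boundary two = deg-pos D two ∘ proj₁ ∘ ∈-filter⁻ onBoundary?

  boundary-lower-bound : 2 ≤ size D → e * j + 2 ≤ b
  boundary-lower-bound two = +-cancelˡ-≤ b _ _ (begin
    b + (e * j + 2)      ≤⟨ +-monoˡ-≤ (e * j + 2) (length≤∑ (deg-pos-boundary two)) ⟩
    s + (e * j + 2)      ≡⟨ +-assoc s (e * j) 2 ⟨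
    s + e * j + 2        ≡⟨ boundary-identity ⟩
    b + b                ∎)
    where open ≤-Reasoning

  full⇒boundary≡ : Full D → b ≡ e * j + 2
  full⇒boundary≡ (_ , full) = +-cancelˡ-≡ b _ _ (begin
    b + b                ≡⟨ boundary-identity ⟨
    s + e * j + 2        ≡⟨ cong (λ s → s + e * j + 2) s≡b ⟩
    b + e * j + 2        ≡⟨ +-assoc b (e * j) 2 ⟩
    b + (e * j + 2)      ∎)
    where
    open ≡-Reasoning
    s≡b : s ≡ b
    s≡b = trans (∑-cong full) (trans (∑-const 1 (boundary D)) (*-identityʳ b))

  boundary≤⇒full : 2 ≤ size D → b ≤ e * j + 2 → Full D
  boundary≤⇒full two b≤ = two , ∑≤length⇒≡1 (deg-pos-boundary two) s≤b
    where
    s≤b : s ≤ b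
    s≤b = +-cancelʳ-≤ (e * j + 2) s b (begin
      s + (e * j + 2)    ≡⟨ +-assoc s (e * j) 2 ⟨
      s + e * j + 2      ≡⟨ boundary-identity ⟩
      b + b              ≤⟨ +-monoʳ-≤ b b≤ ⟩
      b + (e * j + 2)    ∎)
      where open ≤-Reasoning

-- Caterpillars

module _ {e : ℕ} where

  private variable
    i m q : ℕ
    y : Vertex (2 + e)

  alternating : ℕ → Fin (2 + e)
  alternating 0             = zero
  alternating 1             = suc zero
  alternating (suc (suc i)) = alternating i

  alternating-suc≢ : ∀ i → alternating (suc i) ≢ alternating i
  alternating-suc≢ 0             ()
  alternating-suc≢ 1             ()
  alternating-suc≢ (suc (suc i)) = alternating-suc≢ i

  suc-suc≢alternating : ∀ (a : Fin e) i → suc (suc a) ≢ alternating i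
  suc-suc≢alternating a 0             ()
  suc-suc≢alternating a 1             ()
  suc-suc≢alternating a (suc (suc i)) = suc-suc≢alternating a i

  spine : ℕ → Vertex (2 + e)
  spine 0       = []
  spine (suc i) = alternating i ∷ spine i

  length-spine : ∀ i → length (spine i) ≡ i
  length-spine 0       = refl
  length-spine (suc i) = cong suc (length-spine i)

  spine-injective : spine i ≡ spine m → i ≡ m
  spine-injective {i} {m} eq = trans (sym (length-spine i)) (trans (cong length eq) (length-spine m))

  spine-reduced : ∀ i → Reduced (spine i)
  spine-reduced 0             = tt
  spine-reduced 1             = tt
  spine-reduced (suc (suc i)) = alternating-suc≢ i , spine-reduced (suc i)

  legs : ℕ → List (Vertex (2 + e))
  legs i = tabulate (λ a → suc (suc a) ∷ spine i)

  ∈-legs⁻ : y ∈ legs i → ∃[ a ] y ≡ suc (suc a) ∷ spine i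
  ∈-legs⁻ = ∈-tabulate⁻

  legs-unique : ∀ i → Unique (legs i)
  legs-unique i = Unique.tabulate⁺ (Fin.suc-injective ∘ Fin.suc-injective ∘ proj₁ ∘ ∷-injective)

  -- The path spine 0, …, spine (m + 1), whose letters alternate between 0 and 1, with the e legs
  -- of letters 2, …, e + 1 attached to each of spine 1, …, spine m. These m vertices are interior
  -- and there are m (e + 1) + 2 vertices in all.
  caterpillar-verts : ℕ → List (Vertex (2 + e))
  caterpillar-verts 0       = spine 1 ∷ spine 0 ∷ []
  caterpillar-verts (suc m) = spine (2 + m) ∷ legs (suc m) ++ caterpillar-verts m

  length-caterpillar-verts : ∀ m → length (caterpillar-verts m) ≡ m * suc e + 2
  length-caterpillar-verts 0       = refl
  length-caterpillar-verts (suc m) = cong suc (begin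
    length (legs (suc m) ++ caterpillar-verts m)          ≡⟨ length-++ (legs (suc m)) ⟩
    length (legs (suc m)) + length (caterpillar-verts m)  ≡⟨ cong₂ _+_ (length-tabulate {n = e} _) (length-caterpillar-verts m) ⟩
    e + (m * suc e + 2)                                   ≡⟨ +-assoc e (m * suc e) 2 ⟨
    e + m * suc e + 2                                     ∎)
    where open ≡-Reasoning

  caterpillar-verts-step : caterpillar-verts m ⊆ caterpillar-verts (suc m)
  caterpillar-verts-step {m} = there ∘ ∈-++⁺ʳ (legs (suc m))

  caterpillar-verts-mono : i ≤ m → caterpillar-verts i ⊆ caterpillar-verts m
  caterpillar-verts-mono = mono ∘ ≤⇒≤′
    where
    mono : i ≤′ m → caterpillar-verts i ⊆ caterpillar-verts m
    mono ≤′-refl        = id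
    mono (≤′-step i≤′m) = caterpillar-verts-step ∘ mono i≤′m

  spine∈caterpillar-verts : i ≤ suc m → spine i ∈ caterpillar-verts m
  spine∈caterpillar-verts {0}     _         = caterpillar-verts-mono z≤n (there (here refl))
  spine∈caterpillar-verts {suc i} (s≤s i≤m) = caterpillar-verts-mono i≤m (first i)
    where
    first : ∀ i → spine (suc i) ∈ caterpillar-verts i
    first 0       = here refl
    first (suc i) = here refl

  caterpillar-verts-short : y ∈ caterpillar-verts m → length y ≤ suc m
  caterpillar-verts-short {m = 0}     (here refl)         = ≤-refl
  caterpillar-verts-short {m = 0}     (there (here refl)) = z≤n
  caterpillar-verts-short {m = suc m} (here refl)         = ≤-reflexive (length-spine (2 + m))
  caterpillar-verts-short {m = suc m} (there y∈) with ∈-++⁻ (legs (suc m)) y∈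
  ... | inj₁ y∈legs with ∈-legs⁻ y∈legs
  ...   | _ , refl = ≤-reflexive (length-spine (2 + m))
  caterpillar-verts-short {m = suc m} (there y∈) | inj₂ y∈C = m≤n⇒m≤1+n (caterpillar-verts-short y∈C)

  caterpillar-verts-unique : ∀ m → Unique (caterpillar-verts m)
  caterpillar-verts-unique 0       = ((λ ()) ∷ []) ∷ [] ∷ []
  caterpillar-verts-unique (suc m) =
    All.tabulate spine≢ ∷ Unique.++⁺ (legs-unique (suc m)) (caterpillar-verts-unique m) disjoint
    where
    longer≢ : ∀ {y z} → z ∈ caterpillar-verts m → length y ≡ 2 + m → y ≢ z
    longer≢ z∈ len refl = 1+n≰n (≤-trans (≤-reflexive (sym len)) (caterpillar-verts-short z∈))
    spine≢ : ∀ {z} → z ∈ legs (suc m) ++ caterpillar-verts m → spine (2 + m) ≢ z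
    spine≢ z∈ with ∈-++⁻ (legs (suc m)) z∈
    ... | inj₁ z∈legs with ∈-legs⁻ z∈legs
    ...   | a , refl = suc-suc≢alternating a (suc m) ∘ sym ∘ proj₁ ∘ ∷-injective
    spine≢ z∈ | inj₂ z∈C = longer≢ z∈C (length-spine (2 + m))
    disjoint : ∀ {z} → z ∈ legs (suc m) × z ∈ caterpillar-verts m → ⊥
    disjoint (z∈legs , z∈C) with ∈-legs⁻ z∈legs
    ... | _ , refl = longer≢ z∈C (cong suc (length-spine (suc m))) refl

  caterpillar-verts-reduced : ∀ m → All Reduced (caterpillar-verts m)
  caterpillar-verts-reduced 0       = tt ∷ tt ∷ []
  caterpillar-verts-reduced (suc m) =
    spine-reduced (2 + m) ∷ All.++⁺ (All.tabulate leg-reduced) (caterpillar-verts-reduced m)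
    where
    leg-reduced : ∀ {y} → y ∈ legs (suc m) → Reduced y
    leg-reduced y∈ with ∈-legs⁻ y∈
    ... | a , refl = suc-suc≢alternating a m , spine-reduced (suc m)

  caterpillar-verts-parentClosed : ∀ m → ParentClosed (caterpillar-verts m)
  caterpillar-verts-parentClosed 0       (here refl)         = there (here refl)
  caterpillar-verts-parentClosed 0       (there (here ()))
  caterpillar-verts-parentClosed 0       (there (there ()))
  caterpillar-verts-parentClosed (suc m) (here refl)         = spine∈caterpillar-verts (n≤1+n (suc m))
  caterpillar-verts-parentClosed (suc m) (there y∈) with ∈-++⁻ (legs (suc m)) y∈
  ... | inj₁ y∈legs with ∈-legs⁻ y∈legs
  ...   | _ , refl = spine∈caterpillar-verts (n≤1+n (suc m))
  caterpillar-verts-parentClosed (suc m) (there y∈) | inj₂ y∈C =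
    caterpillar-verts-step (caterpillar-verts-parentClosed m y∈C)

  caterpillar : ℕ → Domain (2 + e)
  caterpillar m = record
    { verts     = caterpillar-verts m
    ; unique    = caterpillar-verts-unique m
    ; reduced   = caterpillar-verts-reduced m
    ; nonempty  = ∈-length (spine∈caterpillar-verts {0} {m} z≤n)
    ; connected = parentClosed⇒connected (caterpillar-verts-parentClosed m)
    }

  neighbours : ℕ → List (Vertex (2 + e))
  neighbours i = spine i ∷ spine (2 + i) ∷ legs (suc i)

  neighbours-adjacent : y ∈ neighbours i → Adjacent (spine (suc i)) y
  neighbours-adjacent {i = i} (here refl)                 = parent (alternating i) (spine i)
  neighbours-adjacent {i = i} (there (here refl))         = child (alternating (suc i)) (spine (suc i))
  neighbours-adjacent {i = i} (there (there y∈)) with ∈-legs⁻ y∈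
  ... | a , refl = child (suc (suc a)) (spine (suc i))

  neighbours-unique : ∀ i → Unique (neighbours i)
  neighbours-unique i = All.tabulate spine≢ ∷ All.tabulate spine′≢ ∷ legs-unique (suc i)
    where
    spine≢ : ∀ {z} → z ∈ spine (2 + i) ∷ legs (suc i) → spine i ≢ z
    spine≢ (here refl) = x≢a∷b∷x
    spine≢ (there z∈) with ∈-legs⁻ z∈
    ... | _ , refl = x≢a∷b∷x
    spine′≢ : ∀ {z} → z ∈ legs (suc i) → spine (2 + i) ≢ z
    spine′≢ z∈ with ∈-legs⁻ z∈
    ... | a , refl = suc-suc≢alternating a (suc i) ∘ sym ∘ proj₁ ∘ ∷-injective

  neighbours⊆caterpillar-verts : neighbours i ⊆ caterpillar-verts (suc i)
  neighbours⊆caterpillar-verts {i} (here refl)         = spine∈caterpillar-verts (≤-trans (n≤1+n i) (n≤1+n (suc i)))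
  neighbours⊆caterpillar-verts     (there (here refl)) = here refl
  neighbours⊆caterpillar-verts     (there (there y∈))  = there (∈-++⁺ˡ y∈)

  spine∈interior : i < q → spine (suc i) ∈ interior (caterpillar q)
  spine∈interior {i} {q} i<q = ∈-interior⁺ (caterpillar q)
    (spine∈caterpillar-verts (m≤n⇒m≤1+n i<q))
    (begin
      2 + e                    ≡⟨ cong (2 +_) (length-tabulate {n = e} _) ⟨
      length (neighbours i)    ≤⟨ length-mono-⊆ _≟ᵥ_ (neighbours-unique i) neighbour∈N ⟩
      deg (caterpillar q) (spine (suc i)) ∎)
    where
    open ≤-Reasoning
    neighbour∈N : neighbours i ⊆ filterᵇ (adj (spine (suc i))) (caterpillar-verts q)
    neighbour∈N y∈ = ∈-filter⁺ (T? ∘ adj (spine (suc i)))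
      (caterpillar-verts-mono i<q (neighbours⊆caterpillar-verts y∈)) (Adjacent⇒adj (neighbours-adjacent y∈))

  caterpillar-interior : ∀ q → q ≤ length (interior (caterpillar q))
  caterpillar-interior q = begin
    q                                        ≡⟨ length-applyUpTo (spine ∘ suc) q ⟨
    length (applyUpTo (spine ∘ suc) q)       ≤⟨ length-mono-⊆ _≟ᵥ_ spines-unique spines⊆interior ⟩
    length (interior (caterpillar q))        ∎
    where
    open ≤-Reasoning
    spines-unique : Unique (applyUpTo (spine ∘ suc) q)
    spines-unique = Unique.applyUpTo⁺₁ (spine ∘ suc) q
      (λ i<j _ → <⇒≢ i<j ∘ suc-injective ∘ spine-injective)
    spines⊆interior : applyUpTo (spine ∘ suc) q ⊆ interior (caterpillar q)
    spines⊆interior y∈ with ∈-applyUpTo⁻ (spine ∘ suc) y∈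
    ... | _ , i<q , refl = spine∈interior i<q

module _ {e : ℕ} where

  full⇒optimal : (D : Domain (2 + e)) → Full D → Optimal D
  full⇒optimal D full D′ size≡ with ≤-total (length (interior D)) (length (interior D′))
  ... | inj₁ j≤j′ = begin
    length (boundary D)                  ≡⟨ full⇒boundary≡ D full ⟩
    e * length (interior D) + 2          ≤⟨ +-monoˡ-≤ 2 (*-monoʳ-≤ e j≤j′) ⟩
    e * length (interior D′) + 2         ≤⟨ boundary-lower-bound D′ (subst (2 ≤_) (sym size≡) (proj₁ full)) ⟩
    length (boundary D′)                 ∎
    where open ≤-Reasoning
  ... | inj₂ j′≤j = +-cancelʳ-≤ (length (interior D)) _ _ (begin
    length (boundary D) + length (interior D)     ≡⟨ size≡boundary+interior D ⟨
    size D                                        ≡⟨ size≡ ⟨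
    size D′                                       ≡⟨ size≡boundary+interior D′ ⟩
    length (boundary D′) + length (interior D′)   ≤⟨ +-monoʳ-≤ (length (boundary D′)) j′≤j ⟩
    length (boundary D′) + length (interior D)    ∎)
    where open ≤-Reasoning

  optimal⇒full : (D : Domain (2 + e)) → 2 ≤ size D → ∀ q → size D ≡ q * suc e + 2 → Optimal D → Full D
  optimal⇒full D two q size≡ optimal = boundary≤⇒full D two (+-cancelʳ-≤ j b (e * j + 2) (begin
    b + j                  ≡⟨ size≡boundary+interior D ⟨
    size D                 ≡⟨ size≡ ⟩
    q * suc e + 2          ≤⟨ +-monoˡ-≤ 2 (*-monoˡ-≤ (suc e) q≤j) ⟩
    j * suc e + 2          ≡⟨ rearrange j e ⟩
    e * j + 2 + j          ∎))
    where
    open ≤-Reasoning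
    C : Domain (2 + e)
    C = caterpillar q
    b j : ℕ
    b = length (boundary D)
    j = length (interior D)
    q≤j : q ≤ j
    q≤j = +-cancelˡ-≤ b q j (begin
      b + q                                       ≤⟨ +-mono-≤ (optimal C (trans (length-caterpillar-verts q) (sym size≡))) (caterpillar-interior q) ⟩
      length (boundary C) + length (interior C)   ≡⟨ size≡boundary+interior C ⟨
      size C                                      ≡⟨ length-caterpillar-verts q ⟩
      q * suc e + 2                               ≡⟨ size≡ ⟨
      size D                                      ≡⟨ size≡boundary+interior D ⟩
      b + j                                       ∎)
    rearrange : ∀ j e → j * suc e + 2 ≡ e * j + 2 + j
    rearrange = solve-∀

corollary5p3 : (d : ℕ) → 2 ≤ d → (D : Domain d) → 2 ≤ size D → (d ∸ 1) ∣ (size D ∸ 2) → Optimal D ⇔ Full D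
corollary5p3 (suc (suc e)) (s≤s (s≤s z≤n)) D two (divides q size∸2≡q*[d-1]) =
  mk⇔ (optimal⇒full D two q (trans (sym (m∸n+n≡m two)) (cong (_+ 2) size∸2≡q*[d-1]))) (full⇒optimal D)
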